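{- Let $G$ be a graph, $I_s,I_t$ independent sets of $G$ of size $k$, $X:=I_s\cup I_t$, and let $I$ be an independent set that is 3-clean for $I_s$ with associated 2-class $C$ (respectively, $(2,2)$-clean for $I_s$ with associated 2-classes $C,C'$). If at least one vertex of $N(C)\cap X$ (respectively, of $N(C\cup C')\cap X$) is not in $I_s$, then there is a reconfiguration sequence transforming $I_s$ into $I$ that uses only vertices of $I_s\cup I$.
   Context: A token-jumping step on an independent set $S$ replaces $S$ by $(S\setminus\{u\})\cup\{w\}$ ($u\in S$, $w\notin S$) provided the result is independent; a reconfiguration sequence is a finite sequence of such steps, and it uses the vertices that ever carry a token. For $Y\subseteq X$, $\mathcal{C}_Y:=\{v\in V(G)\setminus X : N(v)\cap X=Y\}$; a 2-class is a set $\mathcal{C}_Y$ with $|Y|=2$, and the two vertices of $Y$ are its key vertices. Here $I$ is an independent subset of $V(G)\setminus X$ all of whose vertices lie in 2-classes, with $|I|\ge k$; "transforming $I_s$ into $I$" means reaching a set of $k$ vertices of $I$. $I$ is weakly $I_s$-greedy if there are an ordering $a_1,\dots,a_k$ of $I_s$ and distinct vertices $b_1,\dots,b_k$ of $I$ such that for every $t\in\{2,\dots,k\}$ the set $\{b_1,\dots,b_t,a_{t+1},\dots,a_k\}$ is independent ($\{a_1,a_2\}$ and $\{b_1,b_2\}$ are the activation pairs). $I$ is 3-clean for $I_s$ if it is weakly $I_s$-greedy with such orderings where some 2-class $C$ contains at least three vertices of $I$ and $b_1,b_2\in C$. $I$ is $(2,2)$-clean for $I_s$ if it is weakly $I_s$-greedy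 with such orderings where some vertex $x$ is a key vertex of two 2-classes $C,C'$ each containing two vertices of $I$, and $\{b_1,b_2\}=C\cap I$. -}

module Defs where

open import Data.Nat using (ℕ; _<_; _≤_)
open import Data.Fin using (Fin; toℕ)
open import Data.Fin.Subset using (Subset; _∈_; _∉_; _⊆_; _∪_; _-_; ⁅_⁆; ∣_∣)
open import Data.Product using (Σ; ∃; ∃-syntax; _×_; _,_)
open import Data.Sum using (_⊎_)
open import Data.Empty using (⊥)
open import Function.Bundles using (_⇔_)
open import Function.Definitions using (Injective)
open import Relation.Nullary using (¬_; Dec; yes; no)
open import Relation.Binary.PropositionalEquality using (_≡_; _≢_)
open import Data.Nat.Properties using (_<?_)

record Graph (n : ℕ) : Set₁ where
  field
    E      : Fin n → Fin n → Set
    sym    : ∀ {u v} → E u v → E v u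
    irrefl : ∀ {v} → ¬ E v v
open Graph public

module _ {n : ℕ} (G : Graph n) where

  Independent : Subset n → Set
  Independent S = ∀ u v → u ∈ S → v ∈ S → ¬ E G u v

  InClass : Subset n → Subset n → Fin n → Set
  InClass X Y v = v ∉ X × (∀ x → x ∈ X → (E G v x ⇔ x ∈ Y))

  TwoClassKey : Subset n → Subset n → Set
  TwoClassKey X Y = Y ⊆ X × ∣ Y ∣ ≡ 2

  InSome2Class : Subset n → Fin n → Set
  InSome2Class X v = ∃[ Y ] (TwoClassKey X Y × InClass X Y v)

  TJStep : Subset n → Subset n → Set
  TJStep S S' = ∃[ u ] ∃[ w ] (u ∈ S × w ∉ S × S' ≡ (S - u) ∪ ⁅ w ⁆ × Independent S')

  data ReconfWithin (P : Subset n) : Subset n → Subset n → Set where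
    done : ∀ {S} → S ⊆ P → ReconfWithin P S S
    step : ∀ {S S' T} → S ⊆ P → TJStep S S' → ReconfWithin P S' T → ReconfWithin P S T

  -- The set {b_1,…,b_t, a_{t+1},…,a_k} listed as a family indexed by Fin k (0-based: index i < t uses b).
  mixFam : {k : ℕ} → (Fin k → Fin n) → (Fin k → Fin n) → ℕ → Fin k → Fin n
  mixFam a b t i with toℕ i <? t
  ... | yes _ = b i
  ... | no  _ = a i

  IndependentFam : {k : ℕ} → (Fin k → Fin n) → Set
  IndependentFam f = ∀ i j → ¬ E G (f i) (f j)

  IsOrdering : {k : ℕ} → Subset n → (Fin k → Fin n) → Set
  IsOrdering Is a = Injective _≡_ _≡_ a × (∀ i → a i ∈ Is) × (∀ v → v ∈ Is → ∃[ i ] a i ≡ v)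

  WeaklyGreedyWith : (k : ℕ) → Subset n → Subset n → (Fin k → Fin n) → (Fin k → Fin n) → Set
  WeaklyGreedyWith k Is I a b =
    IsOrdering Is a × Injective _≡_ _≡_ b × (∀ i → b i ∈ I) ×
    (∀ t → 2 ≤ t → t ≤ k → IndependentFam (mixFam a b t))

  FirstTwo : {k : ℕ} → (Fin k → Fin n) → (Fin n → Set) → Set
  FirstTwo {k} b P = ∃[ i ] ∃[ j ] (toℕ i ≡ 0 × toℕ j ≡ 1 × P (b i) × P (b j))

  ThreeClean : (k : ℕ) → Subset n → Subset n → Subset n → Subset n → Set
  ThreeClean k X Is I Y =
    TwoClassKey X Y ×
    (∃[ u ] ∃[ v ] ∃[ w ] (u ∈ I × v ∈ I × w ∈ I × u ≢ v × u ≢ w × v ≢ w ×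
        InClass X Y u × InClass X Y v × InClass X Y w)) ×
    (∃[ a ] ∃[ b ] (WeaklyGreedyWith k Is I a b × FirstTwo b (InClass X Y)))

  TwoTwoClean : (k : ℕ) → Subset n → Subset n → Subset n → Subset n → Subset n → Set
  TwoTwoClean k X Is I Y Y' =
    TwoClassKey X Y × TwoClassKey X Y' × Y ≢ Y' ×
    (∃[ x ] (x ∈ Y × x ∈ Y')) ×
    (∃[ u ] ∃[ v ] (u ∈ I × v ∈ I × u ≢ v × InClass X Y u × InClass X Y v)) ×
    (∃[ u ] ∃[ v ] (u ∈ I × v ∈ I × u ≢ v × InClass X Y' u × InClass X Y' v)) ×
    (∃[ a ] ∃[ b ] (WeaklyGreedyWith k Is I a b ×
       (∃[ i ] ∃[ j ] (toℕ i ≡ 0 × toℕ j ≡ 1 ×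
          (∀ v → v ∈ I → InClass X Y v → (v ≡ b i ⊎ v ≡ b j)) ×
          InClass X Y (b i) × InClass X Y (b j)))))

  NbrOutside : Subset n → Subset n → (Fin n → Set) → Set
  NbrOutside X Is inC = ∃[ x ] (x ∈ X × x ∉ Is × ∃[ c ] (inC c × E G c x))

  TransformsInto : ℕ → Subset n → Subset n → Set
  TransformsInto k Is I = ∃[ T ] (T ⊆ I × ∣ T ∣ ≡ k × ReconfWithin (Is ∪ I) Is T)

module Submission where

-- Once the tokens sit on {b₁, b₂, a₃, …, a_k}, weak greediness lets the token on a_t jump to b_t
-- for t = 3, …, k, so only the activation Iₛ ⇝ {b₁, b₂, a₃, …, a_k} needs an argument. The vertices
-- b₁, b₂ lie in the 2-class C_Y, so each sees exactly Y inside X. If a₂ ∉ Y, the token on a₁ jumps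
-- to b₁ and then the one on a₂ to b₂ (symmetrically if a₁ ∉ Y); a key z ∈ Y outside Iₛ forces this
-- case, since |Y| = 2. Otherwise Y = {a₁, a₂} and z is a key of the second class C_Y', whose other
-- key is some a_j; a vertex u ∈ C_Y' ∩ I then sees only a_j in Iₛ, so the token on a_j parks on u,
-- the other activation token jumps to its b, and the token on u moves to b_j.

open import Data.Empty using (⊥-elim)
open import Data.Fin using (Fin; zero; suc; toℕ; fromℕ<; _≟_)
open import Data.Fin.Properties using (toℕ-injective; toℕ<n; toℕ-fromℕ<)
open import Data.Fin.Subset using (Subset; inside; outside; _∈_; _∉_; _⊆_; _∪_; _-_; ⁅_⁆; ∣_∣)
open import Data.Fin.Subset.Properties
  using (p⊆p∪q; q⊆p∪q; x∈p∪q⁻; x∈p∪q⁺; p─q⊆p; p─⊥≡p; x∈p∧x≢y⇒x∈p-y; x∈⁅x⁆; x∈⁅y⁆⇒x≡y;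
         ∣⁅x⁆∣≡1; ∪-identityʳ; p⊆q⇒∣p∣≤∣q∣; _∈?_)
open import Data.Nat using (ℕ; zero; suc; _+_; _∸_; _≤_; _<_; _≥_; s≤s; s≤s⁻¹; z≤n; _<?_)
import Data.Nat.Properties as ℕ
open import Data.Product using (∃-syntax; _×_; _,_; proj₁; proj₂)
open import Data.Sum using (_⊎_; inj₁; inj₂)
open import Data.Vec using (_∷_; here; there)
open import Data.Vec.Functional using (updateAt)
open import Data.Vec.Functional.Properties using (updateAt-updates; updateAt-minimal)
open import Function using (_∘_; const)
open import Function.Bundles using (Equivalence)
open import Function.Definitions using (Injective)
open import Relation.Nullary using (¬_; Dec; yes; no)
open import Relation.Binary.PropositionalEquality
  using (_≡_; _≢_; _≗_; refl; sym; trans; cong; subst; subst₂)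

open import Defs hiding (sym)

x∉p-x : ∀ {n} (p : Subset n) (x : Fin n) → x ∉ p - x
x∉p-x (_ ∷ p) (suc x) (there x∈p-x) = x∉p-x p x x∈p-x

x∈p⇒suc∣p-x∣≡∣p∣ : ∀ {n} (p : Subset n) {x} → x ∈ p → suc ∣ p - x ∣ ≡ ∣ p ∣
x∈p⇒suc∣p-x∣≡∣p∣ (inside ∷ p) here = cong (suc ∘ ∣_∣) (p─⊥≡p p)
x∈p⇒suc∣p-x∣≡∣p∣ (inside ∷ p) (there x∈p) = cong suc (x∈p⇒suc∣p-x∣≡∣p∣ p x∈p)
x∈p⇒suc∣p-x∣≡∣p∣ (outside ∷ p) (there x∈p) = x∈p⇒suc∣p-x∣≡∣p∣ p x∈p

x∉p⇒∣p∪⁅x⁆∣≡suc∣p∣ : ∀ {n} (p : Subset n) (x : Fin n) → x ∉ p → ∣ p ∪ ⁅ x ⁆ ∣ ≡ suc ∣ p ∣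
x∉p⇒∣p∪⁅x⁆∣≡suc∣p∣ (inside ∷ p) zero x∉p = ⊥-elim (x∉p here)
x∉p⇒∣p∪⁅x⁆∣≡suc∣p∣ (outside ∷ p) zero _ = cong (suc ∘ ∣_∣) (∪-identityʳ p)
x∉p⇒∣p∪⁅x⁆∣≡suc∣p∣ (inside ∷ p) (suc x) x∉p = cong suc (x∉p⇒∣p∪⁅x⁆∣≡suc∣p∣ p x (x∉p ∘ there))
x∉p⇒∣p∪⁅x⁆∣≡suc∣p∣ (outside ∷ p) (suc x) x∉p = x∉p⇒∣p∪⁅x⁆∣≡suc∣p∣ p x (x∉p ∘ there)

x∈p∧y∉p⇒∣p-x∪⁅y⁆∣≡∣p∣ : ∀ {n} {p : Subset n} {x y} → x ∈ p → y ∉ p → ∣ (p - x) ∪ ⁅ y ⁆ ∣ ≡ ∣ p ∣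
x∈p∧y∉p⇒∣p-x∪⁅y⁆∣≡∣p∣ {p = p} {x} {y} x∈p y∉p =
  trans (x∉p⇒∣p∪⁅x⁆∣≡suc∣p∣ (p - x) y (y∉p ∘ p─q⊆p p ⁅ x ⁆)) (x∈p⇒suc∣p-x∣≡∣p∣ p x∈p)

∣p∣≡2⇒∉ : ∀ {n} {p : Subset n} {x y z} → ∣ p ∣ ≡ 2 → x ∈ p → y ∈ p → x ≢ y → z ≢ x → z ≢ y → z ∉ p
∣p∣≡2⇒∉ {p = p} {x} {y} {z} ∣p∣≡2 x∈p y∈p x≢y z≢x z≢y z∈p = ℕ.<-irrefl refl 3≤2
  where
  xyz : Subset _
  xyz = (⁅ x ⁆ ∪ ⁅ y ⁆) ∪ ⁅ z ⁆

  y∉x : y ∉ ⁅ x ⁆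
  y∉x = x≢y ∘ sym ∘ x∈⁅y⁆⇒x≡y x

  z∉xy : z ∉ ⁅ x ⁆ ∪ ⁅ y ⁆
  z∉xy m with x∈p∪q⁻ ⁅ x ⁆ ⁅ y ⁆ m
  ... | inj₁ z∈x = z≢x (x∈⁅y⁆⇒x≡y x z∈x)
  ... | inj₂ z∈y = z≢y (x∈⁅y⁆⇒x≡y y z∈y)

  ∣xyz∣≡3 : ∣ xyz ∣ ≡ 3
  ∣xyz∣≡3 = trans (x∉p⇒∣p∪⁅x⁆∣≡suc∣p∣ _ z z∉xy)
              (cong suc (trans (x∉p⇒∣p∪⁅x⁆∣≡suc∣p∣ _ y y∉x) (cong suc (∣⁅x⁆∣≡1 x))))

  xyz⊆p : xyz ⊆ p
  xyz⊆p m with x∈p∪q⁻ (⁅ x ⁆ ∪ ⁅ y ⁆) ⁅ z ⁆ m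
  ... | inj₂ v∈z = subst (_∈ p) (sym (x∈⁅y⁆⇒x≡y z v∈z)) z∈p
  ... | inj₁ v∈xy with x∈p∪q⁻ ⁅ x ⁆ ⁅ y ⁆ v∈xy
  ...   | inj₁ v∈x = subst (_∈ p) (sym (x∈⁅y⁆⇒x≡y x v∈x)) x∈p
  ...   | inj₂ v∈y = subst (_∈ p) (sym (x∈⁅y⁆⇒x≡y y v∈y)) y∈p

  3≤2 : 3 ≤ 2
  3≤2 = subst₂ _≤_ ∣xyz∣≡3 ∣p∣≡2 (p⊆q⇒∣p∣≤∣q∣ xyz⊆p)

_[_]≔_ : ∀ {A : Set} {k} → (Fin k → A) → Fin k → A → Fin k → A
f [ j ]≔ w = updateAt f j (const w)

update-cases : ∀ {A : Set} {k} (f : Fin k → A) (j : Fin k) (w : A) (i : Fin k) →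
               (i ≡ j × (f [ j ]≔ w) i ≡ w) ⊎ (i ≢ j × (f [ j ]≔ w) i ≡ f i)
update-cases f j w i with i ≟ j
... | yes refl = inj₁ (refl , updateAt-updates j f)
... | no i≢j = inj₂ (i≢j , updateAt-minimal i j f i≢j)

update-avoids : ∀ {A : Set} {k} {f : Fin k → A} {j v w} →
                (∀ i → i ≢ j → f i ≢ w) → v ≢ w → ∀ i → (f [ j ]≔ v) i ≢ w
update-avoids {f = f} {j} {v} {w} f≢w v≢w i with update-cases f j v i
... | inj₁ (_ , e) = v≢w ∘ trans (sym e)
... | inj₂ (i≢j , e) = f≢w i i≢j ∘ trans (sym e)

-- j and j' are the 0-based positions of the activation pairs {a₁, a₂} and {b₁, b₂}, in either order.
ActivationPair : ∀ {k} → Fin k → Fin k → Set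
ActivationPair j j' = (toℕ j ≡ 0 × toℕ j' ≡ 1) ⊎ (toℕ j ≡ 1 × toℕ j' ≡ 0)

activationPair-swap : ∀ {k} {j j' : Fin k} → ActivationPair j j' → ActivationPair j' j
activationPair-swap (inj₁ (e , e')) = inj₂ (e' , e)
activationPair-swap (inj₂ (e , e')) = inj₁ (e' , e)

activationPair-≢ : ∀ {k} {j j' : Fin k} → ActivationPair j j' → j ≢ j'
activationPair-≢ (inj₁ (e , e')) refl = ℕ.0≢1+n (trans (sym e) e')
activationPair-≢ (inj₂ (e , e')) refl = ℕ.0≢1+n (trans (sym e') e)

activationPair-< : ∀ {k} {j j' : Fin k} → ActivationPair j j' → toℕ j < 2
activationPair-< (inj₁ (e , _)) = subst (_< 2) (sym e) (s≤s z≤n)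
activationPair-< (inj₂ (e , _)) = subst (_< 2) (sym e) (s≤s (s≤s z≤n))

activationPair-2≤ : ∀ {k} {j j' : Fin k} → ActivationPair j j' → 2 ≤ k
activationPair-2≤ {j = j'} (inj₂ (e , _)) = subst (_< _) e (toℕ<n j')
activationPair-2≤ {j' = j'} (inj₁ (_ , e)) = subst (_< _) e (toℕ<n j')

activationPair-≮ : ∀ {k} {j j' i : Fin k} → ActivationPair j j' → i ≢ j → i ≢ j' → ¬ toℕ i < 2
activationPair-≮ {i = i} pair i≢j i≢j' i<2 with toℕ i in eq | i<2 | pair
... | 0 | _ | inj₁ (e , _) = i≢j (toℕ-injective (trans eq (sym e)))
... | 0 | _ | inj₂ (_ , e') = i≢j' (toℕ-injective (trans eq (sym e')))
... | 1 | _ | inj₁ (_ , e') = i≢j' (toℕ-injective (trans eq (sym e')))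
... | 1 | _ | inj₂ (e , _) = i≢j (toℕ-injective (trans eq (sym e)))
... | suc (suc _) | s≤s (s≤s ()) | _

module _ {n : ℕ} (G : Graph n) where

  ReconfWithin-⊆ : ∀ {P S T} → ReconfWithin G P S T → T ⊆ P
  ReconfWithin-⊆ (done T⊆P) = T⊆P
  ReconfWithin-⊆ (step _ _ r) = ReconfWithin-⊆ r

  ReconfWithin-snoc : ∀ {P S T U} → ReconfWithin G P S T → TJStep G T U → U ⊆ P → ReconfWithin G P S U
  ReconfWithin-snoc (done T⊆P) s U⊆P = step T⊆P s (done U⊆P)
  ReconfWithin-snoc (step S⊆P s r) s' U⊆P = step S⊆P s (ReconfWithin-snoc r s' U⊆P)

  ReconfWithin-preserves-∣∣ : ∀ {P S T} → ReconfWithin G P S T → ∣ S ∣ ≡ ∣ T ∣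
  ReconfWithin-preserves-∣∣ (done _) = refl
  ReconfWithin-preserves-∣∣ (step _ (_ , _ , u∈S , w∉S , refl , _) r) =
    trans (sym (x∈p∧y∉p⇒∣p-x∪⁅y⁆∣≡∣p∣ u∈S w∉S)) (ReconfWithin-preserves-∣∣ r)

  ordering-independent : ∀ {k S} {f : Fin k → Fin n} → IsOrdering G S f → IndependentFam G f → Independent G S
  ordering-independent (_ , _ , onto) indep u v u∈S v∈S with onto u u∈S | onto v v∈S
  ... | i , refl | j , refl = indep i j

  ordering-cong : ∀ {k S} {f g : Fin k → Fin n} → IsOrdering G S f → f ≗ g → IsOrdering G S g
  ordering-cong {S = S} (inj , ∈S , onto) f≗g =
    (λ e → inj (trans (f≗g _) (trans e (sym (f≗g _))))) ,
    (λ i → subst (_∈ S) (f≗g i) (∈S i)) ,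
    (λ v v∈S → let i , e = onto v v∈S in i , trans (sym (f≗g i)) e)

  independentFam-cong : ∀ {k} {f g : Fin k → Fin n} → IndependentFam G f → f ≗ g → IndependentFam G g
  independentFam-cong indep f≗g i j = indep i j ∘ subst₂ (E G) (sym (f≗g i)) (sym (f≗g j))

  update-independent : ∀ {k} {f : Fin k → Fin n} {j w} → IndependentFam G f →
                       (∀ i → i ≢ j → ¬ E G w (f i)) → IndependentFam G (f [ j ]≔ w)
  update-independent {f = f} {j} {w} indep w≁f x y with update-cases f j w x | update-cases f j w y
  ... | inj₁ (_ , ex) | inj₁ (_ , ey) = irrefl G ∘ subst₂ (E G) ex ey
  ... | inj₁ (_ , ex) | inj₂ (y≢j , ey) = w≁f y y≢j ∘ subst₂ (E G) ex ey
  ... | inj₂ (x≢j , ex) | inj₁ (_ , ey) = w≁f x x≢j ∘ Graph.sym G ∘ subst₂ (E G) ex ey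
  ... | inj₂ (_ , ex) | inj₂ (_ , ey) = indep x y ∘ subst₂ (E G) ex ey

  ordering-update : ∀ {k S} {f : Fin k → Fin n} {j w} → IsOrdering G S f → (∀ i → f i ≢ w) →
                    IsOrdering G ((S - f j) ∪ ⁅ w ⁆) (f [ j ]≔ w)
  ordering-update {S = S} {f} {j} {w} (inj , ∈S , onto) f≢w = inj' , ∈S' , onto'
    where
    inj' : Injective _≡_ _≡_ (f [ j ]≔ w)
    inj' {x} {y} e with update-cases f j w x | update-cases f j w y
    ... | inj₁ (refl , _) | inj₁ (refl , _) = refl
    ... | inj₁ (_ , ex) | inj₂ (_ , ey) = ⊥-elim (f≢w y (trans (sym ey) (trans (sym e) ex)))
    ... | inj₂ (_ , ex) | inj₁ (_ , ey) = ⊥-elim (f≢w x (trans (sym ex) (trans e ey)))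
    ... | inj₂ (_ , ex) | inj₂ (_ , ey) = inj (trans (sym ex) (trans e ey))

    ∈S' : ∀ i → (f [ j ]≔ w) i ∈ (S - f j) ∪ ⁅ w ⁆
    ∈S' i with update-cases f j w i
    ... | inj₁ (_ , e) = subst (_∈ _) (sym e) (x∈p∪q⁺ (inj₂ (x∈⁅x⁆ w)))
    ... | inj₂ (i≢j , e) = subst (_∈ _) (sym e) (x∈p∪q⁺ (inj₁ (x∈p∧x≢y⇒x∈p-y (∈S i) (i≢j ∘ inj))))

    onto' : ∀ v → v ∈ (S - f j) ∪ ⁅ w ⁆ → ∃[ i ] (f [ j ]≔ w) i ≡ v
    onto' v m with x∈p∪q⁻ (S - f j) ⁅ w ⁆ m
    ... | inj₂ v∈w = j , trans (updateAt-updates j f) (sym (x∈⁅y⁆⇒x≡y w v∈w))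
    ... | inj₁ v∈S-fj with onto v (p─q⊆p S ⁅ f j ⁆ v∈S-fj)
    ...   | i , refl with update-cases f j w i
    ...     | inj₁ (refl , _) = ⊥-elim (x∉p-x S (f j) v∈S-fj)
    ...     | inj₂ (_ , e) = i , e

  Reaches : ∀ {k} → Subset n → Subset n → (Fin k → Fin n) → Set
  Reaches P S f = ∃[ T ] (IsOrdering G T f × ReconfWithin G P S T)

  reaches-start : ∀ {k P S} {f : Fin k → Fin n} → IsOrdering G S f → S ⊆ P → Reaches P S f
  reaches-start {S = S} ord S⊆P = S , ord , done S⊆P

  reaches-cong : ∀ {k P S} {f g : Fin k → Fin n} → Reaches P S f → f ≗ g → Reaches P S g
  reaches-cong (T , ord , r) f≗g = T , ordering-cong ord f≗g , r

  reaches-jump : ∀ {k P S} {f : Fin k → Fin n} {j w} → Reaches P S f → (∀ i → f i ≢ w) → w ∈ P →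
                 IndependentFam G (f [ j ]≔ w) → Reaches P S (f [ j ]≔ w)
  reaches-jump {P = P} {f = f} {j} {w} (T , ord , r) f≢w w∈P indep =
    T' , ord' , ReconfWithin-snoc r (f j , w , proj₁ (proj₂ ord) j , w∉T , refl , ordering-independent ord' indep) T'⊆P
    where
    T' : Subset n
    T' = (T - f j) ∪ ⁅ w ⁆

    ord' : IsOrdering G T' (f [ j ]≔ w)
    ord' = ordering-update ord f≢w

    w∉T : w ∉ T
    w∉T w∈T = let i , e = proj₂ (proj₂ ord) w w∈T in f≢w i e

    T'⊆P : T' ⊆ P
    T'⊆P m with x∈p∪q⁻ (T - f j) ⁅ w ⁆ m
    ... | inj₁ v∈T-fj = ReconfWithin-⊆ r (p─q⊆p T ⁅ f j ⁆ v∈T-fj)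
    ... | inj₂ v∈w = subst (_∈ P) (sym (x∈⁅y⁆⇒x≡y w v∈w)) w∈P

  module _ {k : ℕ} (a b : Fin k → Fin n) where

    mix-< : ∀ {t i} → toℕ i < t → mixFam G a b t i ≡ b i
    mix-< {t} {i} i<t with toℕ i <? t
    ... | yes _ = refl
    ... | no i≮t = ⊥-elim (i≮t i<t)

    mix-≮ : ∀ {t i} → ¬ toℕ i < t → mixFam G a b t i ≡ a i
    mix-≮ {t} {i} i≮t with toℕ i <? t
    ... | yes i<t = ⊥-elim (i≮t i<t)
    ... | no _ = refl

    mix-full : mixFam G a b k ≗ b
    mix-full i = mix-< (toℕ<n i)

    mix-cases : ∀ t i → (toℕ i < t × mixFam G a b t i ≡ b i) ⊎ (¬ toℕ i < t × mixFam G a b t i ≡ a i)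
    mix-cases t i = cases (toℕ i <? t)
      where
      cases : Dec (toℕ i < t) → (toℕ i < t × mixFam G a b t i ≡ b i) ⊎ (¬ toℕ i < t × mixFam G a b t i ≡ a i)
      cases (yes i<t) = inj₁ (i<t , mix-< i<t)
      cases (no i≮t) = inj₂ (i≮t , mix-≮ i≮t)

    mix-suc : ∀ {t j} → toℕ j ≡ t → mixFam G a b (suc t) ≗ mixFam G a b t [ j ]≔ b j
    mix-suc {t} {j} refl i with update-cases (mixFam G a b t) j (b j) i | mix-cases t i
    ... | inj₁ (refl , e) | _ = trans (mix-< (ℕ.n<1+n t)) (sym e)
    ... | inj₂ (_ , e) | inj₁ (i<t , e') = trans (mix-< (ℕ.m<n⇒m<1+n i<t)) (sym (trans e e'))
    ... | inj₂ (i≢j , e) | inj₂ (i≮t , e') = trans (mix-≮ i≮1+t) (sym (trans e e'))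
      where
      i≮1+t : ¬ toℕ i < suc t
      i≮1+t i<1+t = i≢j (toℕ-injective (ℕ.≤-antisym (s≤s⁻¹ i<1+t) (ℕ.≮⇒≥ i≮t)))

    mix-avoids : Injective _≡_ _≡_ b → (∀ i j → a i ≢ b j) → ∀ {t j} → ¬ toℕ j < t →
                 ∀ i → mixFam G a b t i ≢ b j
    mix-avoids b-inj a≢b {t} {j} j≮t i with mix-cases t i
    ... | inj₁ (i<t , e) = λ e' → j≮t (subst (λ l → toℕ l < t) (b-inj (trans (sym e) e')) i<t)
    ... | inj₂ (_ , e) = a≢b i j ∘ trans (sym e)

    mix-2-≗ : ∀ {j j'} {g : Fin k → Fin n} → ActivationPair j j' → g j ≡ b j → g j' ≡ b j' →
                 (∀ i → i ≢ j → i ≢ j' → g i ≡ a i) → mixFam G a b 2 ≗ g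
    mix-2-≗ {j} {j'} pair gj gj' gi i with i ≟ j | i ≟ j'
    ... | yes refl | _ = trans (mix-< (activationPair-< pair)) (sym gj)
    ... | no _ | yes refl = trans (mix-< (activationPair-< (activationPair-swap pair))) (sym gj')
    ... | no i≢j | no i≢j' = trans (mix-≮ (activationPair-≮ pair i≢j i≢j')) (sym (gi i i≢j i≢j'))

  adjacent⇒key : ∀ {X Y c x} → InClass G X Y c → x ∈ X → E G c x → x ∈ Y
  adjacent⇒key (_ , nbr) x∈X = Equivalence.to (nbr _ x∈X)

  key⇒adjacent : ∀ {X Y c x} → InClass G X Y c → x ∈ X → x ∈ Y → E G c x
  key⇒adjacent (_ , nbr) x∈X = Equivalence.from (nbr _ x∈X)

module Activation {n : ℕ} (G : Graph n) {k : ℕ} (Is I : Subset n)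
  (Is-indep : Independent G Is) (I-indep : Independent G I)
  (a b : Fin k → Fin n) (a-ord : IsOrdering G Is a) (b-inj : Injective _≡_ _≡_ b)
  (b∈I : ∀ i → b i ∈ I) (mix-indep : ∀ t → 2 ≤ t → t ≤ k → IndependentFam G (mixFam G a b t))
  (b∉Is : ∀ i → b i ∉ Is) where

  P : Subset n
  P = Is ∪ I

  a-inj : Injective _≡_ _≡_ a
  a-inj = proj₁ a-ord

  a∈Is : ∀ i → a i ∈ Is
  a∈Is = proj₁ (proj₂ a-ord)

  a≢ : ∀ {w} → w ∉ Is → ∀ i → a i ≢ w
  a≢ w∉Is i e = w∉Is (subst (_∈ Is) e (a∈Is i))

  b∈P : ∀ i → b i ∈ P
  b∈P i = q⊆p∪q Is I (b∈I i)

  a-indep : IndependentFam G a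
  a-indep i j = Is-indep _ _ (a∈Is i) (a∈Is j)

  start : Reaches G P Is a
  start = reaches-start G a-ord (p⊆p∪q I)

  mix-2-indep : ∀ {j j'} → ActivationPair j j' → IndependentFam G (mixFam G a b 2)
  mix-2-indep pair = mix-indep 2 ℕ.≤-refl (activationPair-2≤ pair)

  b≁a : ∀ {j j' i} → ActivationPair j j' → i ≢ j → i ≢ j' → ¬ E G (b j) (a i)
  b≁a {j} {i = i} pair i≢j i≢j' = mix-2-indep pair j i ∘
    subst₂ (E G) (sym (mix-< G a b (activationPair-< pair))) (sym (mix-≮ G a b (activationPair-≮ pair i≢j i≢j')))

  activate-two : ∀ {j j'} → ActivationPair j j' → ¬ E G (b j) (a j') → Reaches G P Is (mixFam G a b 2)
  activate-two {j} {j'} pair bj≁aj' = reaches-cong G second (sym ∘ mix-2-≗ G a b pair vj vj' vi)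
    where
    j≢j' : j ≢ j'
    j≢j' = activationPair-≢ pair

    f₁ f₂ : Fin k → Fin n
    f₁ = a [ j ]≔ b j
    f₂ = f₁ [ j' ]≔ b j'

    bj≁a : ∀ i → i ≢ j → ¬ E G (b j) (a i)
    bj≁a i i≢j with i ≟ j'
    ... | yes refl = bj≁aj'
    ... | no i≢j' = b≁a pair i≢j i≢j'

    vj : f₂ j ≡ b j
    vj = trans (updateAt-minimal j j' f₁ j≢j') (updateAt-updates j a)

    vj' : f₂ j' ≡ b j'
    vj' = updateAt-updates j' f₁

    vi : ∀ i → i ≢ j → i ≢ j' → f₂ i ≡ a i
    vi i i≢j i≢j' = trans (updateAt-minimal i j' f₁ i≢j') (updateAt-minimal i j a i≢j)

    first : Reaches G P Is f₁
    first = reaches-jump G start (a≢ (b∉Is j)) (b∈P j) (update-independent G a-indep bj≁a)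

    second : Reaches G P Is f₂
    second = reaches-jump G first (update-avoids (λ i _ → a≢ (b∉Is j') i) (j≢j' ∘ b-inj)) (b∈P j')
               (independentFam-cong G (mix-2-indep pair) (mix-2-≗ G a b pair vj vj' vi))

  activate-three : ∀ {j j' u} → ActivationPair j j' → u ∈ I → u ∉ Is → u ≢ b j → u ≢ b j' →
                   (∀ v → v ∈ Is → v ≢ a j → ¬ E G u v) → Reaches G P Is (mixFam G a b 2)
  activate-three {j} {j'} {u} pair u∈I u∉Is u≢bj u≢bj' u≁Is =
    reaches-cong G third (sym ∘ mix-2-≗ G a b pair vj vj' vi)
    where
    j≢j' : j ≢ j'
    j≢j' = activationPair-≢ pair

    f₁ f₂ f₃ : Fin k → Fin n
    f₁ = a [ j ]≔ u
    f₂ = f₁ [ j' ]≔ b j'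
    f₃ = f₂ [ j ]≔ b j

    vj : f₃ j ≡ b j
    vj = updateAt-updates j f₂

    vj' : f₃ j' ≡ b j'
    vj' = trans (updateAt-minimal j' j f₂ (j≢j' ∘ sym)) (updateAt-updates j' f₁)

    vi : ∀ i → i ≢ j → i ≢ j' → f₃ i ≡ a i
    vi i i≢j i≢j' =
      trans (updateAt-minimal i j f₂ i≢j) (trans (updateAt-minimal i j' f₁ i≢j') (updateAt-minimal i j a i≢j))

    f₁-indep : IndependentFam G f₁
    f₁-indep = update-independent G a-indep (λ i i≢j → u≁Is (a i) (a∈Is i) (i≢j ∘ a-inj))

    bj'≁f₁ : ∀ i → i ≢ j' → ¬ E G (b j') (f₁ i)
    bj'≁f₁ i i≢j' with update-cases a j u i
    ... | inj₁ (_ , e) = I-indep _ _ (b∈I j') (subst (_∈ I) (sym e) u∈I)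
    ... | inj₂ (i≢j , e) = subst (¬_ ∘ E G (b j')) (sym e) (b≁a (activationPair-swap pair) i≢j' i≢j)

    first : Reaches G P Is f₁
    first = reaches-jump G start (a≢ u∉Is) (q⊆p∪q Is I u∈I) f₁-indep

    second : Reaches G P Is f₂
    second = reaches-jump G first (update-avoids (λ i _ → a≢ (b∉Is j') i) u≢bj') (b∈P j')
               (update-independent G f₁-indep bj'≁f₁)

    third : Reaches G P Is f₃
    third = reaches-jump G second
              (update-avoids (λ i _ → update-avoids (λ i _ → a≢ (b∉Is j) i) u≢bj i) (j≢j' ∘ sym ∘ b-inj)) (b∈P j)
              (independentFam-cong G (mix-2-indep pair) (mix-2-≗ G a b pair vj vj' vi))

  greedy-phase : ∀ d {t} → d + t ≡ k → 2 ≤ t → Reaches G P Is (mixFam G a b t) → Reaches G P Is b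
  greedy-phase zero refl _ r = reaches-cong G r (mix-full G a b)
  greedy-phase (suc d) {t} d+t≡k 2≤t r =
    greedy-phase d (trans (ℕ.+-suc d t) d+t≡k) 2≤1+t (reaches-cong G jumped (sym ∘ mix-suc G a b toℕj≡t))
    where
    t<k : t < k
    t<k = subst (t <_) d+t≡k (s≤s (ℕ.m≤n+m t d))
    j : Fin k
    j = fromℕ< t<k

    toℕj≡t : toℕ j ≡ t
    toℕj≡t = toℕ-fromℕ< t<k

    2≤1+t : 2 ≤ suc t
    2≤1+t = ℕ.m≤n⇒m≤1+n 2≤t

    jumped : Reaches G P Is (mixFam G a b t [ j ]≔ b j)
    jumped = reaches-jump G r (mix-avoids G a b b-inj (λ i j → a≢ (b∉Is j) i) (ℕ.<-irrefl toℕj≡t)) (b∈P j)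
               (independentFam-cong G (mix-indep (suc t) 2≤1+t t<k) (mix-suc G a b toℕj≡t))

  greedy-completion : 2 ≤ k → ∣ Is ∣ ≡ k → Reaches G P Is (mixFam G a b 2) → TransformsInto G k Is I
  greedy-completion 2≤k ∣Is∣≡k r with greedy-phase (k ∸ 2) (ℕ.m∸n+n≡m 2≤k) ℕ.≤-refl r
  ... | T , (_ , _ , onto) , r' = T , T⊆I , trans (sym (ReconfWithin-preserves-∣∣ G r')) ∣Is∣≡k , r'
    where
    T⊆I : T ⊆ I
    T⊆I {v} v∈T = let i , e = onto v v∈T in subst (_∈ I) e (b∈I i)

module TwoClassActivation {n : ℕ} (G : Graph n) {k : ℕ} (Is It I : Subset n)
  (Is-indep : Independent G Is) (∣Is∣≡k : ∣ Is ∣ ≡ k) (I-indep : Independent G I)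
  (I∩X≡∅ : ∀ {v} → v ∈ I → v ∉ Is ∪ It)
  (a b : Fin k → Fin n) (a-ord : IsOrdering G Is a) (b-inj : Injective _≡_ _≡_ b)
  (b∈I : ∀ i → b i ∈ I) (mix-indep : ∀ t → 2 ≤ t → t ≤ k → IndependentFam G (mixFam G a b t))
  {i₀ i₁ : Fin k} (pair : ActivationPair i₀ i₁)
  {Y : Subset n} (∣Y∣≡2 : ∣ Y ∣ ≡ 2)
  (b₀∈C : InClass G (Is ∪ It) Y (b i₀)) (b₁∈C : InClass G (Is ∪ It) Y (b i₁))
  where

  X : Subset n
  X = Is ∪ It

  Is⊆X : Is ⊆ X
  Is⊆X = p⊆p∪q It

  I∩Is≡∅ : ∀ {v} → v ∈ I → v ∉ Is
  I∩Is≡∅ v∈I = I∩X≡∅ v∈I ∘ Is⊆X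

  open Activation G Is I Is-indep I-indep a b a-ord b-inj b∈I mix-indep (I∩Is≡∅ ∘ b∈I)

  a₀≢a₁ : a i₀ ≢ a i₁
  a₀≢a₁ = activationPair-≢ pair ∘ a-inj

  complete : Reaches G P Is (mixFam G a b 2) → TransformsInto G k Is I
  complete = greedy-completion (activationPair-2≤ pair) ∣Is∣≡k

  activation-unless-pair⊆key : a i₀ ∉ Y ⊎ a i₁ ∉ Y → Reaches G P Is (mixFam G a b 2)
  activation-unless-pair⊆key (inj₁ a₀∉Y) =
    activate-two (activationPair-swap pair) (a₀∉Y ∘ adjacent⇒key G b₁∈C (Is⊆X (a∈Is i₀)))
  activation-unless-pair⊆key (inj₂ a₁∉Y) =
    activate-two pair (a₁∉Y ∘ adjacent⇒key G b₀∈C (Is⊆X (a∈Is i₁)))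

  pair⊈key : ∀ {z} → z ∈ Y → z ∉ Is → a i₀ ∉ Y ⊎ a i₁ ∉ Y
  pair⊈key {z} z∈Y z∉Is with a i₁ ∈? Y
  ... | yes a₁∈Y = inj₁ (∣p∣≡2⇒∉ ∣Y∣≡2 a₁∈Y z∈Y (a≢ z∉Is i₁) a₀≢a₁ (a≢ z∉Is i₀))
  ... | no a₁∉Y = inj₂ a₁∉Y

  activation-via-key : ∀ {z} → z ∈ Y → z ∉ Is → Reaches G P Is (mixFam G a b 2)
  activation-via-key z∈Y z∉Is = activation-unless-pair⊆key (pair⊈key z∈Y z∉Is)

  module _ {Y' z u} (∣Y'∣≡2 : ∣ Y' ∣ ≡ 2) (z∈X : z ∈ X) (z∈Y' : z ∈ Y') (z∉Is : z ∉ Is)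
           (u∈I : u ∈ I) (u∈C' : InClass G X Y' u) where

    u≢ : a i₀ ∈ Y → a i₁ ∈ Y → ∀ {c} → InClass G X Y c → u ≢ c
    u≢ a₀∈Y a₁∈Y c∈C refl = ∣p∣≡2⇒∉ ∣Y∣≡2 a₀∈Y a₁∈Y a₀≢a₁ (a≢ z∉Is i₀ ∘ sym) (a≢ z∉Is i₁ ∘ sym)
      (adjacent⇒key G c∈C z∈X (key⇒adjacent G u∈C' z∈X z∈Y'))

    u≁Is : ∀ {y} → y ∈ Y' → y ∈ Is → ∀ v → v ∈ Is → v ≢ y → ¬ E G u v
    u≁Is y∈Y' y∈Is v v∈Is v≢y = ∣p∣≡2⇒∉ ∣Y'∣≡2 y∈Y' z∈Y' (λ { refl → z∉Is y∈Is }) v≢y (λ { refl → z∉Is v∈Is })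
      ∘ adjacent⇒key G u∈C' (Is⊆X v∈Is)

    activation-via-second-key : ∀ {x} → x ∈ Y → x ∈ Y' → Reaches G P Is (mixFam G a b 2)
    activation-via-second-key {x} x∈Y x∈Y' with a i₀ ∈? Y | a i₁ ∈? Y
    ... | no a₀∉Y | _ = activation-unless-pair⊆key (inj₁ a₀∉Y)
    ... | yes _ | no a₁∉Y = activation-unless-pair⊆key (inj₂ a₁∉Y)
    ... | yes a₀∈Y | yes a₁∈Y with x ≟ a i₀ | x ≟ a i₁
    ...   | yes refl | _ = activate-three pair u∈I (I∩Is≡∅ u∈I)
                             (u≢ a₀∈Y a₁∈Y b₀∈C) (u≢ a₀∈Y a₁∈Y b₁∈C) (u≁Is x∈Y' (a∈Is i₀))
    ...   | no _ | yes refl = activate-three (activationPair-swap pair) u∈I (I∩Is≡∅ u∈I)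
                             (u≢ a₀∈Y a₁∈Y b₁∈C) (u≢ a₀∈Y a₁∈Y b₀∈C) (u≁Is x∈Y' (a∈Is i₁))
    ...   | no x≢a₀ | no x≢a₁ = ⊥-elim (∣p∣≡2⇒∉ ∣Y∣≡2 a₀∈Y a₁∈Y a₀≢a₁ x≢a₀ x≢a₁ x∈Y)

mainTheorem12 : {n : ℕ} (G : Graph n) (k : ℕ) (Is It I : Subset n) →
    Independent G Is → ∣ Is ∣ ≡ k →
    Independent G It → ∣ It ∣ ≡ k →
    Independent G I → ∣ I ∣ ≥ k →
    (∀ v → v ∈ I → InSome2Class G (Is ∪ It) v) →
    ((Y : Subset n) → ThreeClean G k (Is ∪ It) Is I Y →
        NbrOutside G (Is ∪ It) Is (InClass G (Is ∪ It) Y) →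
        TransformsInto G k Is I)
    ×
    ((Y Y' : Subset n) → TwoTwoClean G k (Is ∪ It) Is I Y Y' →
        NbrOutside G (Is ∪ It) Is (λ c → InClass G (Is ∪ It) Y c ⊎ InClass G (Is ∪ It) Y' c) →
        TransformsInto G k Is I)
mainTheorem12 {n} G k Is It I Is-indep ∣Is∣≡k _ _ I-indep _ I-in-2-classes = three-clean , two-two-clean
  where
  I∩X≡∅ : ∀ {v} → v ∈ I → v ∉ Is ∪ It
  I∩X≡∅ v∈I = proj₁ (proj₂ (proj₂ (I-in-2-classes _ v∈I)))

  three-clean : (Y : Subset n) → ThreeClean G k (Is ∪ It) Is I Y →
                NbrOutside G (Is ∪ It) Is (InClass G (Is ∪ It) Y) → TransformsInto G k Is I
  three-clean Y ((_ , ∣Y∣≡2) , _ , a , b , (a-ord , b-inj , b∈I , mix-indep) , _ , _ , e₀ , e₁ , b₀∈C , b₁∈C)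
              (z , z∈X , z∉Is , c , c∈C , c~z) =
    complete (activation-via-key (adjacent⇒key G c∈C z∈X c~z) z∉Is)
    where
    open TwoClassActivation G Is It I Is-indep ∣Is∣≡k I-indep I∩X≡∅ a b a-ord b-inj b∈I mix-indep
           (inj₁ (e₀ , e₁)) ∣Y∣≡2 b₀∈C b₁∈C

  two-two-clean : (Y Y' : Subset n) → TwoTwoClean G k (Is ∪ It) Is I Y Y' →
                  NbrOutside G (Is ∪ It) Is (λ c → InClass G (Is ∪ It) Y c ⊎ InClass G (Is ∪ It) Y' c) →
                  TransformsInto G k Is I
  two-two-clean Y Y' ((_ , ∣Y∣≡2) , (_ , ∣Y'∣≡2) , _ , (x , x∈Y , x∈Y') , _ , (u , _ , u∈I , _ , _ , u∈C' , _) ,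
                      a , b , (a-ord , b-inj , b∈I , mix-indep) , _ , _ , e₀ , e₁ , _ , b₀∈C , b₁∈C)
                (z , z∈X , z∉Is , c , c∈C∪C' , c~z) = complete (activation c∈C∪C')
    where
    open TwoClassActivation G Is It I Is-indep ∣Is∣≡k I-indep I∩X≡∅ a b a-ord b-inj b∈I mix-indep
           (inj₁ (e₀ , e₁)) ∣Y∣≡2 b₀∈C b₁∈C

    activation : InClass G (Is ∪ It) Y c ⊎ InClass G (Is ∪ It) Y' c → Reaches G (Is ∪ I) Is (mixFam G a b 2)
    activation (inj₁ c∈C) = activation-via-key (adjacent⇒key G c∈C z∈X c~z) z∉Is
    activation (inj₂ c∈C') =
      activation-via-second-key ∣Y'∣≡2 z∈X (adjacent⇒key G c∈C' z∈X c~z) z∉Is u∈I u∈C' x∈Y x∈Y'
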